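{- Let $m$ be a positive even integer and $r$ an integer. Let $A, B\subseteq \mathbb{Z}_{m}$ with $A\cup B=\mathbb{Z}_{m}$ and $A\cap B=\{\overline{r}, \overline{r+\frac{m}{2}}\}$. Then $R_{A}(\overline{n})=R_{B}(\overline{n})$ for all $\overline{n}\in \mathbb{Z}_{m}$ if and only if $B=A+\overline{\frac{m}{2}}$.
   Context: $\mathbb{Z}_{m}$ is the set of residue classes modulo $m$. For $\overline{a},\overline{b}\in\mathbb{Z}_m$, write $\overline{a}\leq\overline{b}$ if $a'\le b'$, where $a',b'\in\{0,1,\dots,m-1\}$ are the representatives of $\overline{a},\overline{b}$. For $A\subseteq\mathbb{Z}_m$ and $\overline{n}\in\mathbb{Z}_m$, $R_A(\overline{n})$ denotes the number of solutions of $\overline{n}=\overline{a}+\overline{a'}$ with $\overline{a}\leq\overline{a'}$ and $\overline{a},\overline{a'}\in A$. For $A\subseteq\mathbb{Z}_m$ and $\overline{n}\in\mathbb{Z}_m$, $A+\overline{n}=\{\overline{a}+\overline{n}:\overline{a}\in A\}$. -}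

module Defs where

open import Data.Nat using (ℕ; zero; suc; _+_; _*_; _≤ᵇ_; NonZero)
open import Data.Nat.DivMod using (_%_)
open import Data.Fin using (Fin; toℕ)
open import Data.Bool using (Bool; true; false; _∧_; _∨_; if_then_else_)
open import Data.List using (List; []; _∷_; length; filter; allFin; cartesianProduct)
open import Data.Product using (_×_; _,_)
open import Relation.Binary.PropositionalEquality using (_≡_)
open import Relation.Nullary.Decidable using (⌊_⌋; does)
open import Data.Fin.Properties using (_≟_)
open import Data.Nat.DivMod using (_mod_)

-- A subset of ℤ_m, with ℤ_m represented by Fin m (canonical representatives
-- 0,…,m-1), given by its (decidable) characteristic function.
Subset : ℕ → Set
Subset m = Fin m → Bool

cls : ∀ {m} .{{_ : NonZero m}} → ℕ → Fin m
cls {m} k = k mod m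

_⊕_ : ∀ {m} .{{_ : NonZero m}} → Fin m → Fin m → Fin m
a ⊕ b = cls (toℕ a + toℕ b)

count : {X : Set} → (X → Bool) → List X → ℕ
count f [] = 0
count f (x ∷ xs) = if f x then suc (count f xs) else count f xs

R : ∀ {m} .{{_ : NonZero m}} → Subset m → Fin m → ℕ
R {m} A n = count test (cartesianProduct (allFin m) (allFin m))
  where
  test : Fin m × Fin m → Bool
  test (a , a') = A a ∧ A a' ∧ (toℕ a ≤ᵇ toℕ a') ∧ does ((a ⊕ a') ≟ n)

open import Data.Integer.Base using (ℤ; _%ℕ_)

clsℤ : ∀ {m} .{{_ : NonZero m}} → ℤ → Fin m
clsℤ {m} r = cls (r %ℕ m)

_+ˢ_ : ∀ {m} .{{_ : NonZero m}} → Subset m → Fin m → Subset m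
(A +ˢ n) x = anyL (λ a → A a ∧ does ((a ⊕ n) ≟ x)) (allFin _)
  where
  anyL : (Fin _ → Bool) → List (Fin _) → Bool
  anyL f [] = false
  anyL f (y ∷ ys) = f y ∨ anyL f ys

{-# OPTIONS --safe #-}
module Submission where

-- Write α, β, ε for the indicator functions of A, B and A ∩ B = {r, r + m/2}, so that
-- β = 1 − α + ε. Counting ordered pairs, 2R_χ(n) = Σ_a χ(a)χ(n − a) + #{a ∈ χ : 2a = n}, and
-- both terms are invariant under translating χ by an element c with 2c = 0; this gives
-- R_{A + m/2} = R_A. Conversely, substituting β = 1 − α + ε into this formula turns R_A = R_B into
--   2g(y) + Δ(y + r) = 2 − κ   for all y,
-- where g(y) = 1 + ε(y) − α(y) − α(y + m/2), Δ(n) = Σ_{2a = n} (1 − 2α(a) + ε(a)) and κ is a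
-- constant. The solutions of 2a = 2u are exactly a = u and a = u + m/2, so Δ(2u) = 2g(u), while Δ
-- vanishes off the doubles. As g(r) = 0 this forces κ = 2, and then g(w + r) = 0 follows by strong
-- induction on the representative of w: it holds at 0 and at non-doubles, and passes from v to 2v.
-- Finally g(y) = 0 says exactly that α(y + m/2) = β(y).

open import Defs
open import Level using (0ℓ)
open import Algebra.Bundles using (AbelianGroup; CommutativeMonoid)
open import Algebra.Structures using (IsAbelianGroup)
open import Algebra.Consequences.Propositional using (comm∧idʳ⇒id; comm∧invʳ⇒inv)
import Algebra.Properties.AbelianGroup as AbelianGroupProperties
import Algebra.Properties.CommutativeSemigroup as CommutativeSemigroupProperties
open import Data.Nat as ℕ using (ℕ; zero; suc; s≤s; NonZero; _∸_; _≤ᵇ_)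
import Data.Nat.Properties as ℕ
open import Data.Nat.DivMod
  using (_%_; _/_; m%n%n≡m%n; m<n⇒m%n≡m; %-distribˡ-+; n%n≡0; [m+kn]%n≡m%n; m≡m%n+[m/n]*n;
         m%n*o≡m*o%[n*o]; %-congʳ; m<n*o⇒m/o<n)
open import Data.Nat.Induction using (<-rec)
open import Data.Fin as Fin using (Fin; toℕ)
open import Data.Fin.Properties using (toℕ-injective; toℕ<n; toℕ-fromℕ<; _≟_)
open import Data.Fin.Permutation using (permutation)
open import Data.Integer as ℤ using (ℤ; +_; -[1+_]; 0ℤ; 1ℤ; _+_; _*_; _-_; -_; _%ℕ_; _/ℕ_)
import Data.Integer.Properties as ℤ
open import Data.Integer.DivMod using (a≡a%ℕn+[a/ℕn]*n)
open import Data.Integer.Tactic.RingSolver using (solve-∀)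
open import Algebra.Properties.Semiring.Sum ℤ.+-*-semiring
  using (sum; sum-syntax; ∑-distrib-+; ∑-comm; ∑-permute; sum-cong-≗; sum-replicate-zero; *-distribˡ-sum)
open import Data.Bool using (Bool; true; false; _∧_; _∨_; T)
open import Data.Bool.Properties using (T-≡; ⇔→≡)
open import Data.Bool.ListAction using (any)
open import Data.List using (List; []; _∷_; _++_; map; tabulate; allFin; cartesianProduct)
open import Data.List.Relation.Unary.Any using (satisfied)
open import Data.List.Relation.Unary.Any.Properties using (any⁺; any⁻)
open import Data.List.Membership.Propositional using (lose)
open import Data.List.Membership.Propositional.Properties using (∈-allFin)
open import Data.Product using (_×_; _,_; ∃)
open import Data.Sum as Sum using (_⊎_; inj₁; inj₂)
open import Function using (id; _∘_; _⇔_; mk⇔; Equivalence)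
open import Relation.Nullary using (Dec; yes; no; does; ¬_; contradiction)
open import Relation.Nullary.Decidable using (T?; _⊎-dec_; does-⇔; dec-true; dec-false)
open import Relation.Binary.PropositionalEquality
open import Relation.Binary.PropositionalEquality.Algebra using (isMagma)
open ≡-Reasoning

-- Indicators, sums and counts

⟦_⟧ : Bool → ℤ
⟦ true ⟧  = 1ℤ
⟦ false ⟧ = 0ℤ

δ : ∀ {n} → Fin n → Fin n → ℤ
δ a b = ⟦ does (a ≟ b) ⟧

⟦⟧-injective : ∀ {x y} → ⟦ x ⟧ ≡ ⟦ y ⟧ → x ≡ y
⟦⟧-injective {false} {false} _ = refl
⟦⟧-injective {true}  {true}  _ = refl

⟦∧⟧ : ∀ x y → ⟦ x ∧ y ⟧ ≡ ⟦ x ⟧ * ⟦ y ⟧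
⟦∧⟧ false y = refl
⟦∧⟧ true  y = sym (ℤ.*-identityˡ ⟦ y ⟧)

⟦⟧-idem : ∀ x → ⟦ x ⟧ * ⟦ x ⟧ ≡ ⟦ x ⟧
⟦⟧-idem false = refl
⟦⟧-idem true  = refl

⟦⊎-dec⟧ : ∀ {P Q : Set} (p : Dec P) (q : Dec Q) → ¬ (P × Q) →
          ⟦ does (p ⊎-dec q) ⟧ ≡ ⟦ does p ⟧ + ⟦ does q ⟧
⟦⊎-dec⟧ (yes p) (yes q) ¬pq = contradiction (p , q) ¬pq
⟦⊎-dec⟧ (yes p) (no ¬q) ¬pq = refl
⟦⊎-dec⟧ (no ¬p) q       ¬pq = sym (ℤ.+-identityˡ _)

⟦∧⟧≡1 : ∀ x y → ⟦ x ∧ y ⟧ ≡ 1ℤ → ⟦ x ⟧ ≡ 1ℤ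
⟦∧⟧≡1 true y _ = refl

⟦⟧-complement : ∀ x y → (x ∨ y) ≡ true → ⟦ y ⟧ ≡ 1ℤ - ⟦ x ⟧ + ⟦ x ∧ y ⟧
⟦⟧-complement false true  _ = refl
⟦⟧-complement true  false _ = refl
⟦⟧-complement true  true  _ = refl

∑-δ : ∀ {n} (b : Fin n) (f : Fin n → ℤ) → ∑[ a < n ] (δ a b * f a) ≡ f b
∑-δ {suc n} Fin.zero f = begin
  1ℤ * f Fin.zero + ∑[ a < n ] (0ℤ * f (Fin.suc a)) ≡⟨ cong₂ _+_ (ℤ.*-identityˡ (f Fin.zero)) (sum-replicate-zero n) ⟩
  f Fin.zero + 0ℤ                                     ≡⟨ ℤ.+-identityʳ _ ⟩
  f Fin.zero                                          ∎
∑-δ {suc n} (Fin.suc b) f = trans (ℤ.+-identityˡ (∑[ a < n ] (δ a b * f (Fin.suc a)))) (∑-δ b (f ∘ Fin.suc))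

∑-δ+δ : ∀ {n} (p q : Fin n) (f : Fin n → ℤ) → ∑[ a < n ] ((δ a p + δ a q) * f a) ≡ f p + f q
∑-δ+δ {n} p q f = begin
  ∑[ a < n ] ((δ a p + δ a q) * f a)         ≡⟨ sum-cong-≗ (λ a → ℤ.*-distribʳ-+ (f a) (δ a p) (δ a q)) ⟩
  ∑[ a < n ] (δ a p * f a + δ a q * f a)     ≡⟨ ∑-distrib-+ (λ a → δ a p * f a) (λ a → δ a q * f a) ⟩
  ∑[ a < n ] (δ a p * f a) + ∑[ a < n ] (δ a q * f a) ≡⟨ cong₂ _+_ (∑-δ p f) (∑-δ q f) ⟩
  f p + f q                                  ∎

∑-distrib-+₄ : ∀ {n} (f₁ f₂ f₃ f₄ : Fin n → ℤ) →
  ∑[ a < n ] (f₁ a + f₂ a + f₃ a + f₄ a) ≡ ∑[ a < n ] f₁ a + ∑[ a < n ] f₂ a + ∑[ a < n ] f₃ a + ∑[ a < n ] f₄ a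
∑-distrib-+₄ {n} f₁ f₂ f₃ f₄ = begin
  ∑[ a < n ] (f₁ a + f₂ a + f₃ a + f₄ a)
    ≡⟨ ∑-distrib-+ (λ a → f₁ a + f₂ a + f₃ a) f₄ ⟩
  ∑[ a < n ] (f₁ a + f₂ a + f₃ a) + ∑[ a < n ] f₄ a
    ≡⟨ cong (_+ ∑[ a < n ] f₄ a) (∑-distrib-+ (λ a → f₁ a + f₂ a) f₃) ⟩
  ∑[ a < n ] (f₁ a + f₂ a) + ∑[ a < n ] f₃ a + ∑[ a < n ] f₄ a
    ≡⟨ cong (λ z → z + ∑[ a < n ] f₃ a + ∑[ a < n ] f₄ a) (∑-distrib-+ f₁ f₂) ⟩
  ∑[ a < n ] f₁ a + ∑[ a < n ] f₂ a + ∑[ a < n ] f₃ a + ∑[ a < n ] f₄ a ∎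

∑-reindex : ∀ {n} (σ τ : Fin n → Fin n) → (∀ a → σ (τ a) ≡ a) → (∀ a → τ (σ a) ≡ a) →
            (f : Fin n → ℤ) → ∑[ a < n ] f (σ a) ≡ ∑[ a < n ] f a
∑-reindex σ τ στ τσ f = sym (∑-permute f (permutation σ τ στ τσ))

module _ {X : Set} (f : X → Bool) where

  count-++ : ∀ xs ys → count f (xs ++ ys) ≡ count f xs ℕ.+ count f ys
  count-++ []       ys = refl
  count-++ (x ∷ xs) ys with f x
  ... | true  = cong suc (count-++ xs ys)
  ... | false = count-++ xs ys

  count-tabulate : ∀ {n} (g : Fin n → X) → + count f (tabulate g) ≡ ∑[ i < n ] ⟦ f (g i) ⟧
  count-tabulate {zero}  g = refl
  count-tabulate {suc n} g with f (g Fin.zero)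
  ... | true  = cong (λ z → 1ℤ + z) (count-tabulate (g ∘ Fin.suc))
  ... | false = trans (count-tabulate (g ∘ Fin.suc)) (sym (ℤ.+-identityˡ _))

count-map : ∀ {X Y : Set} (f : Y → Bool) (g : X → Y) xs → count f (map g xs) ≡ count (f ∘ g) xs
count-map f g []       = refl
count-map f g (x ∷ xs) with f (g x)
... | true  = cong suc (count-map f g xs)
... | false = count-map f g xs

count-cartesianProduct : ∀ {X Y : Set} {n} (f : X × Y → Bool) (g : Fin n → X) (ys : List Y) →
  + count f (cartesianProduct (tabulate g) ys) ≡ ∑[ i < n ] (+ count (λ y → f (g i , y)) ys)
count-cartesianProduct {n = zero}  f g ys = refl
count-cartesianProduct {n = suc n} f g ys = begin
  + count f (map (g Fin.zero ,_) ys ++ cartesianProduct (tabulate (g ∘ Fin.suc)) ys)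
    ≡⟨ cong +_ (count-++ f (map (g Fin.zero ,_) ys) _) ⟩
  + count f (map (g Fin.zero ,_) ys) + + count f (cartesianProduct (tabulate (g ∘ Fin.suc)) ys)
    ≡⟨ cong₂ _+_ (cong +_ (count-map f (g Fin.zero ,_) ys)) (count-cartesianProduct f (g ∘ Fin.suc) ys) ⟩
  ∑[ i < suc n ] (+ count (λ y → f (g i , y)) ys) ∎

any-allFin : ∀ {n} (p : Fin n → Bool) → any p (allFin n) ≡ true ⇔ ∃ λ a → p a ≡ true
any-allFin p = mk⇔
  (λ eq → let a , t = satisfied (any⁻ p (allFin _) (Equivalence.from T-≡ eq)) in a , Equivalence.to T-≡ t)
  (λ (a , eq) → Equivalence.to T-≡ (any⁺ p (lose (∈-allFin a) (Equivalence.from T-≡ eq))))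

≤ᵇ-suc : ∀ x y → (suc x ≤ᵇ suc y) ≡ (x ≤ᵇ y)
≤ᵇ-suc zero    y = refl
≤ᵇ-suc (suc x) y = refl

≤ᵇ-total : ∀ {n} (a b : Fin n) → ⟦ toℕ a ≤ᵇ toℕ b ⟧ + ⟦ toℕ b ≤ᵇ toℕ a ⟧ ≡ 1ℤ + δ a b
≤ᵇ-total Fin.zero    Fin.zero    = refl
≤ᵇ-total Fin.zero    (Fin.suc b) = refl
≤ᵇ-total (Fin.suc a) Fin.zero    = refl
≤ᵇ-total (Fin.suc a) (Fin.suc b)
  rewrite ≤ᵇ-suc (toℕ a) (toℕ b) | ≤ᵇ-suc (toℕ b) (toℕ a) = ≤ᵇ-total a b

parity : ∀ k → ∃ λ t → k ≡ 2 ℕ.* t ⊎ k ≡ suc (2 ℕ.* t)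
parity zero = 0 , inj₁ refl
parity (suc k) with parity k
... | t , inj₁ k≡2t   = t , inj₂ (cong suc k≡2t)
... | t , inj₂ k≡2t+1 = suc t , inj₁ (cong suc (trans k≡2t+1 (sym (ℕ.+-suc t (t ℕ.+ 0)))))

-- ℤ/mℤ as an abelian group on Fin m

module _ {m : ℕ} .{{_ : NonZero m}} where

  0̂ : Fin m
  0̂ = cls 0

  neg : Fin m → Fin m
  neg a = cls (m ∸ toℕ a)

  _⊖_ : Fin m → Fin m → Fin m
  a ⊖ b = a ⊕ neg b

  toℕ-cls : ∀ k → toℕ (cls {m} k) ≡ k % m
  toℕ-cls k = toℕ-fromℕ< _

  cls-% : ∀ k → cls {m} (k % m) ≡ cls k
  cls-% k = toℕ-injective (begin
    toℕ (cls (k % m)) ≡⟨ toℕ-cls (k % m) ⟩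
    k % m % m         ≡⟨ m%n%n≡m%n k m ⟩
    k % m             ≡⟨ toℕ-cls k ⟨
    toℕ (cls k)       ∎)

  cls-toℕ : ∀ a → cls (toℕ a) ≡ a
  cls-toℕ a = toℕ-injective (trans (toℕ-cls (toℕ a)) (m<n⇒m%n≡m (toℕ<n a)))

  toℕ⇒cls : ∀ {a k} → toℕ a ≡ k → a ≡ cls k
  toℕ⇒cls {a} eq = trans (sym (cls-toℕ a)) (cong cls eq)

  cls-+ : ∀ s t → cls {m} s ⊕ cls t ≡ cls (s ℕ.+ t)
  cls-+ s t = begin
    cls (toℕ (cls s) ℕ.+ toℕ (cls t)) ≡⟨ cong₂ (λ x y → cls (x ℕ.+ y)) (toℕ-cls s) (toℕ-cls t) ⟩
    cls (s % m ℕ.+ t % m)             ≡⟨ cls-% _ ⟨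
    cls ((s % m ℕ.+ t % m) % m)       ≡⟨ cong cls (%-distribˡ-+ s t m) ⟨
    cls ((s ℕ.+ t) % m)               ≡⟨ cls-% (s ℕ.+ t) ⟩
    cls (s ℕ.+ t)                     ∎

  cls-+-* : ∀ b k → cls {m} (b ℕ.+ k ℕ.* m) ≡ cls b
  cls-+-* b k = trans (sym (cls-% _)) (trans (cong cls ([m+kn]%n≡m%n b k m)) (cls-% b))

  cls-congℤ : ∀ a b d → + a ≡ + b + d * + m → cls {m} a ≡ cls b
  cls-congℤ a b (+ k)    eq = trans (cong cls (ℤ.+-injective (trans eq (cong (λ z → + b + z) (sym (ℤ.pos-* k m)))))) (cls-+-* b k)
  cls-congℤ a b -[1+ k ] eq = sym (cls-congℤ b a (+ suc k) (begin
    + b                                         ≡⟨ cancel (+ b) -[1+ k ] (+ m) ⟩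
    (+ b + -[1+ k ] * + m) + + suc k * + m      ≡⟨ cong (_+ + suc k * + m) eq ⟨
    + a + + suc k * + m                         ∎))
    where
    cancel : ∀ x d y → x ≡ (x + d * y) + (- d) * y
    cancel = solve-∀

  clsℤ-+ : ∀ r k → clsℤ {m} (r + + k) ≡ clsℤ r ⊕ cls k
  clsℤ-+ r k = begin
    cls ((r + + k) %ℕ m)    ≡⟨ cls-congℤ _ _ (r /ℕ m - (r + + k) /ℕ m) (begin
      + ((r + + k) %ℕ m)                                     ≡⟨ move (+ ((r + + k) %ℕ m)) ((r + + k) /ℕ m) (+ m) ⟩
      + ((r + + k) %ℕ m) + (r + + k) /ℕ m * + m - (r + + k) /ℕ m * + m
        ≡⟨ cong (_- (r + + k) /ℕ m * + m) (a≡a%ℕn+[a/ℕn]*n (r + + k) m) ⟨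
      r + + k - (r + + k) /ℕ m * + m
        ≡⟨ cong (λ z → z + + k - (r + + k) /ℕ m * + m) (a≡a%ℕn+[a/ℕn]*n r m) ⟩
      + (r %ℕ m) + r /ℕ m * + m + + k - (r + + k) /ℕ m * + m  ≡⟨ regroup (+ (r %ℕ m)) (+ k) (r /ℕ m) ((r + + k) /ℕ m) (+ m) ⟩
      + (r %ℕ m) + + k + (r /ℕ m - (r + + k) /ℕ m) * + m      ∎) ⟩
    cls (r %ℕ m ℕ.+ k)      ≡⟨ cls-+ (r %ℕ m) k ⟨
    clsℤ r ⊕ cls k          ∎
    where
    move : ∀ x q z → x ≡ x + q * z - q * z
    move = solve-∀
    regroup : ∀ x y p q z → x + p * z + y - q * z ≡ x + y + (p - q) * z
    regroup = solve-∀

  ⊕-comm : ∀ a b → a ⊕ b ≡ b ⊕ a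
  ⊕-comm a b = cong cls (ℕ.+-comm (toℕ a) (toℕ b))

  ⊕-assoc : ∀ a b c → (a ⊕ b) ⊕ c ≡ a ⊕ (b ⊕ c)
  ⊕-assoc a b c = begin
    (a ⊕ b) ⊕ c             ≡⟨ cong ((a ⊕ b) ⊕_) (cls-toℕ c) ⟨
    (a ⊕ b) ⊕ cls (toℕ c)   ≡⟨ cls-+ (toℕ a ℕ.+ toℕ b) (toℕ c) ⟩
    cls (toℕ a ℕ.+ toℕ b ℕ.+ toℕ c)   ≡⟨ cong cls (ℕ.+-assoc (toℕ a) (toℕ b) (toℕ c)) ⟩
    cls (toℕ a ℕ.+ (toℕ b ℕ.+ toℕ c)) ≡⟨ cls-+ (toℕ a) (toℕ b ℕ.+ toℕ c) ⟨
    cls (toℕ a) ⊕ (b ⊕ c)   ≡⟨ cong (_⊕ (b ⊕ c)) (cls-toℕ a) ⟩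
    a ⊕ (b ⊕ c)             ∎

  ⊕-identityʳ : ∀ a → a ⊕ 0̂ ≡ a
  ⊕-identityʳ a = begin
    a ⊕ 0̂                ≡⟨ cong (_⊕ 0̂) (cls-toℕ a) ⟨
    cls (toℕ a) ⊕ cls 0   ≡⟨ cls-+ (toℕ a) 0 ⟩
    cls (toℕ a ℕ.+ 0)     ≡⟨ cong cls (ℕ.+-identityʳ (toℕ a)) ⟩
    cls (toℕ a)           ≡⟨ cls-toℕ a ⟩
    a                     ∎

  ⊕-inverseʳ : ∀ a → a ⊖ a ≡ 0̂
  ⊕-inverseʳ a = begin
    a ⊖ a                            ≡⟨ cong (_⊖ a) (cls-toℕ a) ⟨
    cls (toℕ a) ⊕ cls (m ∸ toℕ a)    ≡⟨ cls-+ (toℕ a) (m ∸ toℕ a) ⟩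
    cls (toℕ a ℕ.+ (m ∸ toℕ a))      ≡⟨ cong cls (ℕ.m+[n∸m]≡n (ℕ.<⇒≤ (toℕ<n a))) ⟩
    cls m                            ≡⟨ cls-% m ⟨
    cls (m % m)                      ≡⟨ cong cls (n%n≡0 m) ⟩
    0̂                                ∎

  ⊕-isAbelianGroup : IsAbelianGroup _≡_ _⊕_ 0̂ neg
  ⊕-isAbelianGroup = record
    { isGroup = record
      { isMonoid = record
        { isSemigroup = record { isMagma = isMagma _⊕_ ; assoc = ⊕-assoc }
        ; identity = comm∧idʳ⇒id ⊕-comm ⊕-identityʳ
        }
      ; inverse = comm∧invʳ⇒inv ⊕-comm ⊕-inverseʳ
      ; ⁻¹-cong = cong neg
      }
    ; comm = ⊕-comm
    }

  ℤ/m : AbelianGroup 0ℓ 0ℓ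
  ℤ/m = record { isAbelianGroup = ⊕-isAbelianGroup }

  open AbelianGroup ℤ/m using (commutativeMonoid)
  open AbelianGroupProperties ℤ/m
    using (//-rightDividesˡ; //-rightDividesʳ; x≈z//y; ∙-cancelʳ; inverseʳ-unique; ⁻¹-∙-comm)
  open CommutativeSemigroupProperties (CommutativeMonoid.commutativeSemigroup commutativeMonoid)
    using (interchange)

  neg-unique : ∀ {a b} → a ⊕ b ≡ 0̂ → b ≡ neg a
  neg-unique {a} {b} = inverseʳ-unique a b

  ⊕-cancelʳ : ∀ x a b → a ⊕ x ≡ b ⊕ x → a ≡ b
  ⊕-cancelʳ = ∙-cancelʳ

  ⊖-⊕-cancel : ∀ a b → (a ⊖ b) ⊕ b ≡ a
  ⊖-⊕-cancel a b = //-rightDividesˡ b a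

  ⊕-⊖-cancel : ∀ a b → (a ⊕ b) ⊖ b ≡ a
  ⊕-⊖-cancel a b = //-rightDividesʳ b a

  a⊖[a⊖b]≡b : ∀ a b → a ⊖ (a ⊖ b) ≡ b
  a⊖[a⊖b]≡b a b = sym (x≈z//y b (a ⊖ b) a (trans (⊕-comm b (a ⊖ b)) (⊖-⊕-cancel a b)))

  ⊕-interchange : ∀ a b c d → (a ⊕ b) ⊕ (c ⊕ d) ≡ (a ⊕ c) ⊕ (b ⊕ d)
  ⊕-interchange = interchange

  double-⊕ : ∀ a b → (a ⊕ b) ⊕ (a ⊕ b) ≡ (a ⊕ a) ⊕ (b ⊕ b)
  double-⊕ a b = interchange a b a b

  double-⊖ : ∀ a b → (a ⊖ b) ⊕ (a ⊖ b) ≡ (a ⊕ a) ⊖ (b ⊕ b)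
  double-⊖ a b = trans (interchange a (neg b) a (neg b)) (cong ((a ⊕ a) ⊕_) (⁻¹-∙-comm b b))

  ∑-translate : ∀ c (f : Fin m → ℤ) → ∑[ a < m ] f (a ⊕ c) ≡ ∑[ a < m ] f a
  ∑-translate c = ∑-reindex (_⊕ c) (_⊖ c) (λ a → ⊖-⊕-cancel a c) (λ a → ⊕-⊖-cancel a c)

  ∑-reflect : ∀ n (f : Fin m → ℤ) → ∑[ a < m ] f (n ⊖ a) ≡ ∑[ a < m ] f a
  ∑-reflect n = ∑-reindex (n ⊖_) (n ⊖_) (a⊖[a⊖b]≡b n) (a⊖[a⊖b]≡b n)

  δ-⊕ : ∀ a b n → δ (a ⊕ b) n ≡ δ b (n ⊖ a)
  δ-⊕ a b n = cong ⟦_⟧ (does-⇔ (mk⇔ (λ eq → x≈z//y b a n (trans (⊕-comm b a) eq))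
                                    (λ { refl → trans (⊕-comm a (n ⊖ a)) (⊖-⊕-cancel n a) }))
                                (a ⊕ b ≟ n) (b ≟ n ⊖ a))

  δ-⊕-cancel : ∀ x y d → δ (x ⊕ d) (y ⊕ d) ≡ δ x y
  δ-⊕-cancel x y d = cong ⟦_⟧ (does-⇔ (mk⇔ (⊕-cancelʳ d x y) (cong (_⊕ d))) (x ⊕ d ≟ y ⊕ d) (x ≟ y))

  -- Representation functions

  rep : Subset m → Fin m → ℤ
  rep χ n = ∑[ a < m ] (⟦ χ a ⟧ * ⟦ χ (n ⊖ a) ⟧)

  halves : Subset m → Fin m → ℤ
  halves χ n = ∑[ a < m ] (δ (a ⊕ a) n * ⟦ χ a ⟧)

  ∑∑ : (Fin m → Fin m → ℤ) → ℤ
  ∑∑ f = ∑[ a < m ] ∑[ b < m ] f a b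

  ∑∑-cong : {f g : Fin m → Fin m → ℤ} → (∀ a b → f a b ≡ g a b) → ∑∑ f ≡ ∑∑ g
  ∑∑-cong f≡g = sum-cong-≗ (λ a → sum-cong-≗ (f≡g a))

  ∑∑-distrib-+ : (f g : Fin m → Fin m → ℤ) →
    ∑∑ (λ a b → f a b + g a b) ≡ ∑∑ f + ∑∑ g
  ∑∑-distrib-+ f g = trans (sum-cong-≗ (λ a → ∑-distrib-+ (f a) (g a))) (∑-distrib-+ (λ a → ∑[ b < m ] f a b) (λ a → ∑[ b < m ] g a b))

  R-double-sum : ∀ χ n → + R χ n ≡ ∑∑ (λ a b → ⟦ χ a ∧ χ b ∧ (toℕ a ≤ᵇ toℕ b) ∧ does (a ⊕ b ≟ n) ⟧)
  R-double-sum χ n = trans (count-cartesianProduct test id (tabulate id)) (sum-cong-≗ (λ a → count-tabulate (λ b → test (a , b)) id))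
    where
    test : Fin m × Fin m → Bool
    test (a , b) = χ a ∧ χ b ∧ (toℕ a ≤ᵇ toℕ b) ∧ does (a ⊕ b ≟ n)

  2R≡rep+halves : ∀ χ n → + 2 * + R χ n ≡ rep χ n + halves χ n
  -- Each pair is counted in both orders: ⟦ a ≤ b ⟧ + ⟦ b ≤ a ⟧ = 1 + δ a b counts the diagonal twice.
  2R≡rep+halves χ n = begin
    + 2 * + R χ n
      ≡⟨ cong (λ z → + 2 * z) R≡∑∑ ⟩
    + 2 * ∑∑ (λ a b → le a b * I a b)
      ≡⟨ 2x≡x+x _ ⟩
    ∑∑ (λ a b → le a b * I a b) + ∑∑ (λ a b → le a b * I a b)
      ≡⟨ cong (λ z → ∑∑ (λ a b → le a b * I a b) + z) transpose ⟩
    ∑∑ (λ a b → le a b * I a b) + ∑∑ (λ a b → le b a * I a b)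
      ≡⟨ ∑∑-distrib-+ _ _ ⟨
    ∑∑ (λ a b → le a b * I a b + le b a * I a b)
      ≡⟨ ∑∑-cong (λ a b → trans (sym (ℤ.*-distribʳ-+ (I a b) (le a b) (le b a)))
                                 (cong (_* I a b) (≤ᵇ-total a b))) ⟩
    ∑∑ (λ a b → (1ℤ + δ a b) * I a b)
      ≡⟨ ∑∑-cong (λ a b → trans (ℤ.*-distribʳ-+ (I a b) 1ℤ (δ a b)) (cong (_+ δ a b * I a b) (ℤ.*-identityˡ (I a b)))) ⟩
    ∑∑ (λ a b → I a b + δ a b * I a b)
      ≡⟨ ∑∑-distrib-+ _ _ ⟩
    ∑∑ I + ∑∑ (λ a b → δ a b * I a b)
      ≡⟨ cong₂ _+_ ∑∑I≡rep ∑∑δI≡halves ⟩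
    rep χ n + halves χ n ∎
    where
    le I : Fin m → Fin m → ℤ
    le a b = ⟦ toℕ a ≤ᵇ toℕ b ⟧
    I a b = ⟦ χ a ⟧ * ⟦ χ b ⟧ * δ (a ⊕ b) n

    2x≡x+x : ∀ x → + 2 * x ≡ x + x
    2x≡x+x = solve-∀

    R≡∑∑ : + R χ n ≡ ∑∑ (λ a b → le a b * I a b)
    R≡∑∑ = trans (R-double-sum χ n) (∑∑-cong λ a b → begin
      ⟦ χ a ∧ χ b ∧ (toℕ a ≤ᵇ toℕ b) ∧ does (a ⊕ b ≟ n) ⟧
        ≡⟨ trans (⟦∧⟧ (χ a) _) (cong (⟦ χ a ⟧ *_) (trans (⟦∧⟧ (χ b) _) (cong (⟦ χ b ⟧ *_) (⟦∧⟧ (toℕ a ≤ᵇ toℕ b) (does (a ⊕ b ≟ n)))))) ⟩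
      ⟦ χ a ⟧ * (⟦ χ b ⟧ * (le a b * δ (a ⊕ b) n))
        ≡⟨ reorder ⟦ χ a ⟧ ⟦ χ b ⟧ (le a b) (δ (a ⊕ b) n) ⟩
      le a b * I a b ∎)
      where
      reorder : ∀ p q l d → p * (q * (l * d)) ≡ l * (p * q * d)
      reorder = solve-∀

    transpose : ∑∑ (λ a b → le a b * I a b) ≡ ∑∑ (λ a b → le b a * I a b)
    transpose = trans (∑-comm (λ a b → le a b * I a b))
                      (∑∑-cong (λ b a → cong (le a b *_) (cong₂ (λ x y → x * δ y n) (ℤ.*-comm ⟦ χ a ⟧ ⟦ χ b ⟧) (⊕-comm a b))))

    ∑∑I≡rep : ∑∑ I ≡ rep χ n
    ∑∑I≡rep = sum-cong-≗ λ a → begin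
      ∑[ b < m ] (⟦ χ a ⟧ * ⟦ χ b ⟧ * δ (a ⊕ b) n)
        ≡⟨ sum-cong-≗ (λ b → trans (ℤ.*-assoc ⟦ χ a ⟧ ⟦ χ b ⟧ _)
                                   (cong (⟦ χ a ⟧ *_) (trans (ℤ.*-comm ⟦ χ b ⟧ _) (cong (_* ⟦ χ b ⟧) (δ-⊕ a b n))))) ⟩
      ∑[ b < m ] (⟦ χ a ⟧ * (δ b (n ⊖ a) * ⟦ χ b ⟧))
        ≡⟨ *-distribˡ-sum ⟦ χ a ⟧ (λ b → δ b (n ⊖ a) * ⟦ χ b ⟧) ⟨
      ⟦ χ a ⟧ * ∑[ b < m ] (δ b (n ⊖ a) * ⟦ χ b ⟧)
        ≡⟨ cong (⟦ χ a ⟧ *_) (∑-δ (n ⊖ a) (λ b → ⟦ χ b ⟧)) ⟩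
      ⟦ χ a ⟧ * ⟦ χ (n ⊖ a) ⟧ ∎

    ∑∑δI≡halves : ∑∑ (λ a b → δ a b * I a b) ≡ halves χ n
    ∑∑δI≡halves = begin
      ∑∑ (λ a b → δ a b * I a b) ≡⟨ ∑-comm (λ a b → δ a b * I a b) ⟩
      ∑∑ (λ b a → δ a b * I a b) ≡⟨ sum-cong-≗ (λ b → ∑-δ b (λ a → I a b)) ⟩
      ∑[ b < m ] I b b                     ≡⟨ sum-cong-≗ (λ b → trans (cong (_* δ (b ⊕ b) n) (⟦⟧-idem (χ b))) (ℤ.*-comm ⟦ χ b ⟧ _)) ⟩
      halves χ n                           ∎

  R-cong : ∀ {χ ψ} → (∀ x → χ x ≡ ψ x) → ∀ n → R χ n ≡ R ψ n
  R-cong {χ} {ψ} χ≗ψ n = ℤ.+-injective (begin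
    + R χ n ≡⟨ R-double-sum χ n ⟩
    ∑∑ (λ a b → ⟦ χ a ∧ χ b ∧ (toℕ a ≤ᵇ toℕ b) ∧ does (a ⊕ b ≟ n) ⟧)
      ≡⟨ ∑∑-cong (λ a b → cong₂ (λ x y → ⟦ x ∧ y ∧ (toℕ a ≤ᵇ toℕ b) ∧ does (a ⊕ b ≟ n) ⟧) (χ≗ψ a) (χ≗ψ b)) ⟩
    ∑∑ (λ a b → ⟦ ψ a ∧ ψ b ∧ (toℕ a ≤ᵇ toℕ b) ∧ does (a ⊕ b ≟ n) ⟧) ≡⟨ R-double-sum ψ n ⟨
    + R ψ n ∎)

  rep-translate : ∀ χ c n → rep (λ x → χ (x ⊕ c)) n ≡ rep χ (n ⊕ (c ⊕ c))
  rep-translate χ c n = begin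
    ∑[ a < m ] (⟦ χ (a ⊕ c) ⟧ * ⟦ χ ((n ⊖ a) ⊕ c) ⟧)
      ≡⟨ sum-cong-≗ (λ a → cong (λ z → ⟦ χ (a ⊕ c) ⟧ * ⟦ χ z ⟧) (shift a)) ⟨
    ∑[ a < m ] (⟦ χ (a ⊕ c) ⟧ * ⟦ χ ((n ⊕ (c ⊕ c)) ⊖ (a ⊕ c)) ⟧)
      ≡⟨ ∑-translate c (λ a → ⟦ χ a ⟧ * ⟦ χ ((n ⊕ (c ⊕ c)) ⊖ a) ⟧) ⟩
    rep χ (n ⊕ (c ⊕ c)) ∎
    where
    shift : ∀ a → (n ⊕ (c ⊕ c)) ⊖ (a ⊕ c) ≡ (n ⊖ a) ⊕ c
    shift a = begin
      (n ⊕ (c ⊕ c)) ⊕ neg (a ⊕ c)     ≡⟨ cong ((n ⊕ (c ⊕ c)) ⊕_) (⁻¹-∙-comm a c) ⟨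
      (n ⊕ (c ⊕ c)) ⊕ (neg a ⊕ neg c) ≡⟨ interchange n (c ⊕ c) (neg a) (neg c) ⟩
      (n ⊖ a) ⊕ ((c ⊕ c) ⊖ c)         ≡⟨ cong ((n ⊖ a) ⊕_) (⊕-⊖-cancel c c) ⟩
      (n ⊖ a) ⊕ c                     ∎

  halves-translate : ∀ χ c n → halves (λ x → χ (x ⊕ c)) n ≡ halves χ (n ⊕ (c ⊕ c))
  halves-translate χ c n = begin
    ∑[ a < m ] (δ (a ⊕ a) n * ⟦ χ (a ⊕ c) ⟧)
      ≡⟨ sum-cong-≗ (λ a → cong (_* ⟦ χ (a ⊕ c) ⟧) (shift a)) ⟨
    ∑[ a < m ] (δ ((a ⊕ c) ⊕ (a ⊕ c)) (n ⊕ (c ⊕ c)) * ⟦ χ (a ⊕ c) ⟧)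
      ≡⟨ ∑-translate c (λ a → δ (a ⊕ a) (n ⊕ (c ⊕ c)) * ⟦ χ a ⟧) ⟩
    halves χ (n ⊕ (c ⊕ c)) ∎
    where
    shift : ∀ a → δ ((a ⊕ c) ⊕ (a ⊕ c)) (n ⊕ (c ⊕ c)) ≡ δ (a ⊕ a) n
    shift a = trans (cong (λ z → δ z (n ⊕ (c ⊕ c))) (double-⊕ a c)) (δ-⊕-cancel (a ⊕ a) n (c ⊕ c))

  R-translate : ∀ χ c n → R (λ x → χ (x ⊕ c)) n ≡ R χ (n ⊕ (c ⊕ c))
  R-translate χ c n = ℤ.+-injective (ℤ.*-cancelˡ-≡ (+ 2) _ _ (begin
    + 2 * + R (λ x → χ (x ⊕ c)) n                            ≡⟨ 2R≡rep+halves (λ x → χ (x ⊕ c)) n ⟩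
    rep (λ x → χ (x ⊕ c)) n + halves (λ x → χ (x ⊕ c)) n     ≡⟨ cong₂ _+_ (rep-translate χ c n) (halves-translate χ c n) ⟩
    rep χ (n ⊕ (c ⊕ c)) + halves χ (n ⊕ (c ⊕ c))             ≡⟨ 2R≡rep+halves χ (n ⊕ (c ⊕ c)) ⟨
    + 2 * + R χ (n ⊕ (c ⊕ c))                                ∎))

  -- The left-hand side is the list search local to _+ˢ_ in Defs, which cannot be named;
  -- its use in +ˢ-any determines it.
  mutual
    +ˢ-unfold : ∀ A c x xs → _ ≡ any (λ a → A a ∧ does (a ⊕ c ≟ x)) xs
    +ˢ-unfold A c x []       = refl
    +ˢ-unfold A c x (y ∷ ys) = cong (A y ∧ does (y ⊕ c ≟ x) ∨_) (+ˢ-unfold A c x ys)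

    +ˢ-any : ∀ A c x → (A +ˢ c) x ≡ any (λ a → A a ∧ does (a ⊕ c ≟ x)) (allFin m)
    +ˢ-any A c x with allFin m
    ... | xs = +ˢ-unfold A c x xs

  +ˢ-translate : ∀ A c x → (A +ˢ c) x ≡ A (x ⊖ c)
  +ˢ-translate A c x = ⇔→≡ (mk⇔ to from)
    where
    p : Fin m → Bool
    p a = A a ∧ does (a ⊕ c ≟ x)

    to : (A +ˢ c) x ≡ true → A (x ⊖ c) ≡ true
    to eq with Equivalence.to (any-allFin p) (trans (sym (+ˢ-any A c x)) eq)
    ... | a , pa with A a in Aa | a ⊕ c ≟ x | pa
    ...   | true | yes refl | _ = trans (cong A (⊕-⊖-cancel a c)) Aa

    from : A (x ⊖ c) ≡ true → (A +ˢ c) x ≡ true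
    from eq = trans (+ˢ-any A c x) (Equivalence.from (any-allFin p) (x ⊖ c , cong₂ _∧_ eq (dec-true ((x ⊖ c) ⊕ c ≟ x) (⊖-⊕-cancel x c))))

module EvenModulus (j : ℕ) where

  private
    h M : ℕ
    h = suc j
    M = 2 ℕ.* h

  half : Fin M
  half = cls h

  toℕ-half : toℕ half ≡ h
  toℕ-half = trans (toℕ-cls h) (m<n⇒m%n≡m (ℕ.m<m+n h ℕ.z<s))

  half⊕half : half ⊕ half ≡ 0̂
  half⊕half = trans (cls-+ h h) (trans (cong cls (cong (h ℕ.+_) (sym (ℕ.+-identityʳ h)))) (trans (sym (cls-% M)) (cong cls (n%n≡0 M))))

  toℕ-double : ∀ w → toℕ (w ⊕ w) ≡ 2 ℕ.* (toℕ w % h)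
  toℕ-double w = begin
    toℕ (w ⊕ w)                  ≡⟨ toℕ-cls {M} (toℕ w ℕ.+ toℕ w) ⟩
    (toℕ w ℕ.+ toℕ w) % M        ≡⟨ cong (_% M) (trans (cong (toℕ w ℕ.+_) (sym (ℕ.+-identityʳ (toℕ w)))) (ℕ.*-comm 2 (toℕ w))) ⟩
    toℕ w ℕ.* 2 % M              ≡⟨ %-congʳ {o = toℕ w ℕ.* 2} (ℕ.*-comm 2 h) ⟩
    toℕ w ℕ.* 2 % (h ℕ.* 2)      ≡⟨ m%n*o≡m*o%[n*o] (toℕ w) h 2 ⟨
    toℕ w % h ℕ.* 2              ≡⟨ ℕ.*-comm (toℕ w % h) 2 ⟩
    2 ℕ.* (toℕ w % h)            ∎

  half≢0̂ : half ≢ 0̂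
  half≢0̂ eq with trans (sym toℕ-half) (cong toℕ eq)
  ... | ()

  x≢x⊕half : ∀ x → x ≢ x ⊕ half
  x≢x⊕half x eq = half≢0̂ (sym (⊕-cancelʳ x 0̂ half (trans (⊕-comm 0̂ x) (trans (⊕-identityʳ x) (trans eq (⊕-comm x half))))))

  double≡0̂ : ∀ w → w ⊕ w ≡ 0̂ → w ≡ 0̂ ⊎ w ≡ half
  double≡0̂ w ww≡0 = multiple (toℕ w / h) (m<n*o⇒m/o<n {toℕ w} {2} {h} (toℕ<n w))
                              (trans (m≡m%n+[m/n]*n (toℕ w) h) (cong (ℕ._+ toℕ w / h ℕ.* h) w%h≡0))
    where
    w%h≡0 : toℕ w % h ≡ 0
    w%h≡0 with toℕ w % h | trans (sym (toℕ-double w)) (cong toℕ ww≡0)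
    ... | zero | _ = refl

    multiple : ∀ q → q ℕ.< 2 → toℕ w ≡ q ℕ.* h → w ≡ 0̂ ⊎ w ≡ half
    multiple 0 _ w≡0 = inj₁ (toℕ⇒cls w≡0)
    multiple 1 _ w≡h = inj₂ (toℕ⇒cls (trans w≡h (ℕ.+-identityʳ h)))
    multiple (suc (suc q)) (s≤s (s≤s ())) _

  a⊕a≡b⊕b⇔ : ∀ a b → a ⊕ a ≡ b ⊕ b ⇔ (a ≡ b ⊎ a ≡ b ⊕ half)
  a⊕a≡b⊕b⇔ a b = mk⇔ to from
    where
    to : a ⊕ a ≡ b ⊕ b → a ≡ b ⊎ a ≡ b ⊕ half
    to eq = Sum.map (λ a⊖b≡0 → trans (sym (⊖-⊕-cancel a b)) (trans (cong (_⊕ b) a⊖b≡0) (trans (⊕-comm 0̂ b) (⊕-identityʳ b))))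
                    (λ a⊖b≡half → trans (sym (⊖-⊕-cancel a b)) (trans (cong (_⊕ b) a⊖b≡half) (⊕-comm half b)))
                    (double≡0̂ (a ⊖ b) (trans (double-⊖ a b) (trans (cong (_⊖ (b ⊕ b)) eq) (⊕-inverseʳ (b ⊕ b)))))

    from : a ≡ b ⊎ a ≡ b ⊕ half → a ⊕ a ≡ b ⊕ b
    from (inj₁ refl) = refl
    from (inj₂ refl) = trans (double-⊕ b half) (trans (cong ((b ⊕ b) ⊕_) half⊕half) (⊕-identityʳ (b ⊕ b)))

  double-induction : (P : Fin M → Set) → P 0̂ → (∀ w → (∀ v → v ⊕ v ≢ w) → P w) →
                     (∀ v → P v → P (v ⊕ v)) → ∀ w → P w
  double-induction P P0̂ Pnon-double Pdouble w = <-rec Q step (toℕ w) w refl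
    where
    Q : ℕ → Set
    Q k = ∀ w → toℕ w ≡ k → P w

    step : ∀ k → (∀ {t} → t ℕ.< k → Q t) → Q k
    step k rec w refl with parity (toℕ w)
    ... | zero  , inj₁ w≡0 = subst P (sym (toℕ⇒cls w≡0)) P0̂
    ... | suc t , inj₁ w≡2t = subst P v⊕v≡w (Pdouble v (rec v<w v (trans (toℕ-cls (suc t)) (m<n⇒m%n≡m (ℕ.<-trans v<w (toℕ<n w))))))
      where
      v : Fin M
      v = cls (suc t)
      v<w : suc t ℕ.< toℕ w
      v<w = subst (suc t ℕ.<_) (sym w≡2t) (ℕ.m<m+n (suc t) ℕ.z<s)
      v⊕v≡w : v ⊕ v ≡ w
      v⊕v≡w = trans (cls-+ (suc t) (suc t)) (sym (toℕ⇒cls (trans w≡2t (cong (suc t ℕ.+_) (ℕ.+-identityʳ (suc t))))))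
    ... | t , inj₂ w≡2t+1 = Pnon-double w (λ v v⊕v≡w → ℕ.even≢odd (toℕ v % h) t (trans (sym (toℕ-double v)) (trans (cong toℕ v⊕v≡w) w≡2t+1)))

  ⊕-half-involutive : ∀ x → (x ⊕ half) ⊕ half ≡ x
  ⊕-half-involutive x = trans (⊕-assoc x half half) (trans (cong (x ⊕_) half⊕half) (⊕-identityʳ x))

  neg-half : neg half ≡ half
  neg-half = sym (neg-unique {a = half} {b = half} half⊕half)

  δ-double : ∀ a b → δ (a ⊕ a) (b ⊕ b) ≡ δ a b + δ a (b ⊕ half)
  δ-double a b = trans (cong ⟦_⟧ (does-⇔ (a⊕a≡b⊕b⇔ a b) (a ⊕ a ≟ b ⊕ b) (a ≟ b ⊎-dec a ≟ b ⊕ half)))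
                       (⟦⊎-dec⟧ (a ≟ b) (a ≟ b ⊕ half) (λ { (refl , eq) → x≢x⊕half a eq }))

  +ˢ-half : ∀ A x → (A +ˢ half) x ≡ A (x ⊕ half)
  +ˢ-half A x = trans (+ˢ-translate A half x) (cong (λ z → A (x ⊕ z)) neg-half)

  R-⊕half : ∀ A n → R (λ x → A (x ⊕ half)) n ≡ R A n
  R-⊕half A n = trans (R-translate A half n) (cong (R A) (trans (cong (n ⊕_) half⊕half) (⊕-identityʳ n)))



module Complement (j : ℕ) (r₀ : Fin (2 ℕ.* suc j)) (A B : Subset (2 ℕ.* suc j))
  (A∪B : ∀ x → (A x ∨ B x) ≡ true)
  (A∩B : ∀ x → ⟦ A x ∧ B x ⟧ ≡ δ x r₀ + δ x (r₀ ⊕ EvenModulus.half j))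
  where

  open EvenModulus j

  private
    M : ℕ
    M = 2 ℕ.* suc j

  r₁ : Fin M
  r₁ = r₀ ⊕ half

  α ε : Fin M → ℤ
  α x = ⟦ A x ⟧
  ε x = δ x r₀ + δ x r₁

  β≡ : ∀ x → ⟦ B x ⟧ ≡ 1ℤ - α x + ε x
  β≡ x = trans (⟦⟧-complement (A x) (B x) (A∪B x)) (cong (λ z → 1ℤ - α x + z) (A∩B x))

  ε-periodic : ∀ x → ε (x ⊕ half) ≡ ε x
  ε-periodic x = begin
    δ (x ⊕ half) r₀ + δ (x ⊕ half) r₁          ≡⟨ cong (λ z → δ (x ⊕ half) z + δ (x ⊕ half) r₁) (⊕-half-involutive r₀) ⟨
    δ (x ⊕ half) (r₁ ⊕ half) + δ (x ⊕ half) r₁ ≡⟨ cong₂ _+_ (δ-⊕-cancel x r₁ half) (δ-⊕-cancel x r₀ half) ⟩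
    δ x r₁ + δ x r₀                           ≡⟨ ℤ.+-comm (δ x r₁) (δ x r₀) ⟩
    ε x                                       ∎

  ε-r₀ : ε r₀ ≡ 1ℤ
  ε-r₀ = cong₂ (λ u v → ⟦ u ⟧ + ⟦ v ⟧) (dec-true (r₀ ≟ r₀) refl) (dec-false (r₀ ≟ r₁) (x≢x⊕half r₀))

  ε-r₁ : ε r₁ ≡ 1ℤ
  ε-r₁ = cong₂ (λ u v → ⟦ u ⟧ + ⟦ v ⟧) (dec-false (r₁ ≟ r₀) (x≢x⊕half r₀ ∘ sym)) (dec-true (r₁ ≟ r₁) refl)

  G g : Fin M → ℤ
  G y = α y + α (y ⊕ half)
  g y = 1ℤ + ε y - G y

  g-r₀ : g r₀ ≡ 0ℤ
  g-r₀ = begin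
    1ℤ + ε r₀ - (α r₀ + α r₁) ≡⟨ cong₂ (λ e a → 1ℤ + e - a) ε-r₀ (cong₂ _+_ (α-r ε-r₀) (α-r ε-r₁)) ⟩
    0ℤ ∎
    where
    α-r : ∀ {x} → ε x ≡ 1ℤ → α x ≡ 1ℤ
    α-r {x} εx≡1 = ⟦∧⟧≡1 (A x) (B x) (trans (A∩B x) εx≡1)

  κ : ℤ
  κ = ∑[ a < M ] (1ℤ - α a + ε a) + ∑[ a < M ] (ε a - α a)

  rep-complement : ∀ y → rep B (y ⊕ r₀) + G y ≡ rep A (y ⊕ r₀) + κ + ((ε y - α y) + (ε y - α (y ⊕ half)))
  rep-complement y = begin
    rep B n + G y
      ≡⟨ cong (λ z → rep B n + z) ∑αε ⟨
    rep B n + ∑[ a < M ] (α a * ε (n ⊖ a))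
      ≡⟨ ∑-distrib-+ (λ a → ⟦ B a ⟧ * ⟦ B (n ⊖ a) ⟧) (λ a → α a * ε (n ⊖ a)) ⟨
    ∑[ a < M ] (⟦ B a ⟧ * ⟦ B (n ⊖ a) ⟧ + α a * ε (n ⊖ a))
      ≡⟨ sum-cong-≗ (λ a → trans (cong₂ (λ u v → u * v + α a * ε (n ⊖ a)) (β≡ a) (β≡ (n ⊖ a)))
                                 (expand (α a) (α (n ⊖ a)) (ε a) (ε (n ⊖ a)))) ⟩
    ∑[ a < M ] (α a * α (n ⊖ a) + (1ℤ - α a + ε a) + (ε (n ⊖ a) - α (n ⊖ a)) + ε a * (ε (n ⊖ a) - α (n ⊖ a)))
      ≡⟨ ∑-distrib-+₄ (λ a → α a * α (n ⊖ a)) (λ a → 1ℤ - α a + ε a) (λ a → ε (n ⊖ a) - α (n ⊖ a)) (λ a → ε a * (ε (n ⊖ a) - α (n ⊖ a))) ⟩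
    rep A n + ∑[ a < M ] (1ℤ - α a + ε a) + ∑[ a < M ] (ε (n ⊖ a) - α (n ⊖ a)) + ∑[ a < M ] (ε a * (ε (n ⊖ a) - α (n ⊖ a)))
      ≡⟨ cong₂ (λ u v → rep A n + ∑[ a < M ] (1ℤ - α a + ε a) + u + v) (∑-reflect n (λ b → ε b - α b)) (at-r (λ b → ε b - α b)) ⟩
    rep A n + ∑[ a < M ] (1ℤ - α a + ε a) + ∑[ a < M ] (ε a - α a) + ((ε y - α y) + (ε (y ⊕ half) - α (y ⊕ half)))
      ≡⟨ cong₂ _+_ (ℤ.+-assoc (rep A n) _ _) (cong (λ e → (ε y - α y) + (e - α (y ⊕ half))) (ε-periodic y)) ⟩
    rep A n + κ + ((ε y - α y) + (ε y - α (y ⊕ half))) ∎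
    where
    n : Fin M
    n = y ⊕ r₀

    at-r : ∀ f → ∑[ a < M ] (ε a * f (n ⊖ a)) ≡ f y + f (y ⊕ half)
    at-r f = trans (∑-δ+δ r₀ r₁ (λ a → f (n ⊖ a))) (cong₂ _+_ (cong f (⊕-⊖-cancel y r₀)) (cong f n⊖r₁))
      where
      n⊖r₁ : n ⊖ r₁ ≡ y ⊕ half
      n⊖r₁ = begin
        n ⊖ r₁                               ≡⟨ cong (_⊖ r₁) (trans (cong (n ⊕_) half⊕half) (⊕-identityʳ n)) ⟨
        (n ⊕ (half ⊕ half)) ⊖ r₁             ≡⟨ cong (_⊖ r₁) (⊕-interchange y half r₀ half) ⟨
        ((y ⊕ half) ⊕ r₁) ⊖ r₁               ≡⟨ ⊕-⊖-cancel (y ⊕ half) r₁ ⟩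
        y ⊕ half                             ∎

    ∑αε : ∑[ a < M ] (α a * ε (n ⊖ a)) ≡ G y
    ∑αε = begin
      ∑[ a < M ] (α a * ε (n ⊖ a))             ≡⟨ ∑-reflect n (λ b → α b * ε (n ⊖ b)) ⟨
      ∑[ a < M ] (α (n ⊖ a) * ε (n ⊖ (n ⊖ a))) ≡⟨ sum-cong-≗ (λ a → trans (cong (λ z → α (n ⊖ a) * ε z) (a⊖[a⊖b]≡b n a)) (ℤ.*-comm (α (n ⊖ a)) (ε a))) ⟩
      ∑[ a < M ] (ε a * α (n ⊖ a))             ≡⟨ at-r α ⟩
      G y                                      ∎

    expand : ∀ p q e e' → (1ℤ - p + e) * (1ℤ - q + e') + p * e' ≡ p * q + (1ℤ - p + e) + (e' - q) + e * (e' - q)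
    expand = solve-∀

  Δ : Fin M → ℤ
  Δ n = ∑[ a < M ] (δ (a ⊕ a) n * (1ℤ - α a - α a + ε a))

  halves-complement : ∀ n → halves B n ≡ halves A n + Δ n
  halves-complement n = begin
    ∑[ a < M ] (δ (a ⊕ a) n * ⟦ B a ⟧)
      ≡⟨ sum-cong-≗ (λ a → trans (cong (δ (a ⊕ a) n *_) (β≡ a)) (split (δ (a ⊕ a) n) (α a) (ε a))) ⟩
    ∑[ a < M ] (δ (a ⊕ a) n * α a + δ (a ⊕ a) n * (1ℤ - α a - α a + ε a))
      ≡⟨ ∑-distrib-+ (λ a → δ (a ⊕ a) n * α a) (λ a → δ (a ⊕ a) n * (1ℤ - α a - α a + ε a)) ⟩
    halves A n + Δ n ∎
    where
    split : ∀ d p e → d * (1ℤ - p + e) ≡ d * p + d * (1ℤ - p - p + e)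
    split = solve-∀

  Δ-double : ∀ u → Δ (u ⊕ u) ≡ + 2 * g u
  Δ-double u = begin
    ∑[ a < M ] (δ (a ⊕ a) (u ⊕ u) * f a)      ≡⟨ sum-cong-≗ (λ a → cong (_* f a) (δ-double a u)) ⟩
    ∑[ a < M ] ((δ a u + δ a (u ⊕ half)) * f a) ≡⟨ ∑-δ+δ u (u ⊕ half) f ⟩
    f u + f (u ⊕ half)                        ≡⟨ cong (λ e → f u + (1ℤ - α (u ⊕ half) - α (u ⊕ half) + e)) (ε-periodic u) ⟩
    (1ℤ - α u - α u + ε u) + (1ℤ - α (u ⊕ half) - α (u ⊕ half) + ε u) ≡⟨ collect (α u) (α (u ⊕ half)) (ε u) ⟩
    + 2 * g u                                 ∎
    where
    f : Fin M → ℤ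
    f a = 1ℤ - α a - α a + ε a
    collect : ∀ a a' e → (1ℤ - a - a + e) + (1ℤ - a' - a' + e) ≡ + 2 * (1ℤ + e - (a + a'))
    collect = solve-∀

  Δ-non-double : ∀ n → (∀ v → v ⊕ v ≢ n) → Δ n ≡ 0ℤ
  Δ-non-double n non-double = trans
    (sum-cong-≗ (λ a → cong (λ b → ⟦ b ⟧ * (1ℤ - α a - α a + ε a)) (dec-false (a ⊕ a ≟ n) (non-double a))))
    (sum-replicate-zero M)

  module _ (R≡ : ∀ n → R A n ≡ R B n) where

    balance : ∀ y → κ - + 2 + + 2 * g y + Δ (y ⊕ r₀) ≡ 0ℤ
    balance y = begin
      κ - + 2 + + 2 * g y + Δ n          ≡⟨ expand κ (ε y) (α y) (α (y ⊕ half)) (Δ n) ⟩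
      κ + X + Δ n - G y                  ≡⟨ shift P (κ + X + Δ n) (G y) ⟩
      P + (κ + X + Δ n) - (P + G y)      ≡⟨ cong (λ z → P + (κ + X + Δ n) - z) P+G≡ ⟩
      P + (κ + X + Δ n) - (P + (κ + X + Δ n)) ≡⟨ ℤ.+-inverseʳ (P + (κ + X + Δ n)) ⟩
      0ℤ                                 ∎
      where
      n : Fin M
      n = y ⊕ r₀

      X P : ℤ
      X = (ε y - α y) + (ε y - α (y ⊕ half))
      P = rep A n + halves A n

      P+G≡ : P + G y ≡ P + (κ + X + Δ n)
      P+G≡ = begin
        P + G y                            ≡⟨ cong (_+ G y) (trans (sym (2R≡rep+halves A n)) (trans (cong (λ k → + 2 * + k) (R≡ n)) (2R≡rep+halves B n))) ⟩
        rep B n + halves B n + G y         ≡⟨ swap (rep B n) (halves B n) (G y) ⟩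
        rep B n + G y + halves B n         ≡⟨ cong₂ _+_ (rep-complement y) (halves-complement n) ⟩
        rep A n + κ + X + (halves A n + Δ n) ≡⟨ regroup (rep A n) κ X (halves A n) (Δ n) ⟩
        P + (κ + X + Δ n)                  ∎
        where
        swap : ∀ p q r → p + q + r ≡ p + r + q
        swap = solve-∀
        regroup : ∀ p k x h d → p + k + x + (h + d) ≡ p + h + (k + x + d)
        regroup = solve-∀

      expand : ∀ k e a a' d → k - + 2 + + 2 * (1ℤ + e - (a + a')) + d ≡ k + ((e - a) + (e - a')) + d - (a + a')
      expand = solve-∀

      shift : ∀ p q r → q - r ≡ p + q - (p + r)
      shift = solve-∀

    κ≡2 : κ ≡ + 2
    κ≡2 = begin
      κ                                                ≡⟨ add-back κ ⟩
      κ - + 2 + + 2 * 0ℤ + 0ℤ + + 2                     ≡⟨ cong (_+ + 2) (cong₂ (λ u d → κ - + 2 + + 2 * u + d) (sym g-r₀) Δ≡0) ⟩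
      κ - + 2 + + 2 * g r₀ + Δ (r₀ ⊕ r₀) + + 2          ≡⟨ cong (_+ + 2) (balance r₀) ⟩
      + 2                                              ∎
      where
      add-back : ∀ k → k ≡ k - + 2 + + 2 * 0ℤ + 0ℤ + + 2
      add-back = solve-∀
      Δ≡0 : 0ℤ ≡ Δ (r₀ ⊕ r₀)
      Δ≡0 = sym (trans (Δ-double r₀) (cong (+ 2 *_) g-r₀))

    g-from-Δ : ∀ y → Δ (y ⊕ r₀) ≡ 0ℤ → g y ≡ 0ℤ
    g-from-Δ y Δ≡0 = ℤ.*-cancelˡ-≡ (+ 2) (g y) 0ℤ (begin
      + 2 * g y                                  ≡⟨ pad (+ 2 * g y) ⟩
      + 2 - + 2 + + 2 * g y + 0ℤ                 ≡⟨ cong₂ (λ k d → k - + 2 + + 2 * g y + d) (sym κ≡2) (sym Δ≡0) ⟩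
      κ - + 2 + + 2 * g y + Δ (y ⊕ r₀)           ≡⟨ balance y ⟩
      0ℤ                                         ∎)
      where
      pad : ∀ x → x ≡ + 2 - + 2 + x + 0ℤ
      pad = solve-∀

    g≡0 : ∀ y → g y ≡ 0ℤ
    g≡0 y = subst (λ z → g z ≡ 0ℤ) (⊖-⊕-cancel y r₀)
      (double-induction (λ w → g (w ⊕ r₀) ≡ 0ℤ) base non-double doubling (y ⊖ r₀))
      where
      base : g (0̂ ⊕ r₀) ≡ 0ℤ
      base = trans (cong g (trans (⊕-comm 0̂ r₀) (⊕-identityʳ r₀))) g-r₀

      non-double : ∀ w → (∀ v → v ⊕ v ≢ w) → g (w ⊕ r₀) ≡ 0ℤ
      non-double w nd = g-from-Δ (w ⊕ r₀) (Δ-non-double ((w ⊕ r₀) ⊕ r₀) λ v vv≡ → nd (v ⊖ r₀) (begin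
        (v ⊖ r₀) ⊕ (v ⊖ r₀)           ≡⟨ double-⊖ v r₀ ⟩
        (v ⊕ v) ⊖ (r₀ ⊕ r₀)           ≡⟨ cong (_⊖ (r₀ ⊕ r₀)) (trans vv≡ (⊕-assoc w r₀ r₀)) ⟩
        (w ⊕ (r₀ ⊕ r₀)) ⊖ (r₀ ⊕ r₀)   ≡⟨ ⊕-⊖-cancel w (r₀ ⊕ r₀) ⟩
        w                             ∎))

      doubling : ∀ v → g (v ⊕ r₀) ≡ 0ℤ → g ((v ⊕ v) ⊕ r₀) ≡ 0ℤ
      doubling v gv≡0 = g-from-Δ ((v ⊕ v) ⊕ r₀) (begin
        Δ (((v ⊕ v) ⊕ r₀) ⊕ r₀)        ≡⟨ cong Δ (trans (⊕-assoc (v ⊕ v) r₀ r₀) (sym (double-⊕ v r₀))) ⟩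
        Δ ((v ⊕ r₀) ⊕ (v ⊕ r₀))        ≡⟨ Δ-double (v ⊕ r₀) ⟩
        + 2 * g (v ⊕ r₀)               ≡⟨ cong (+ 2 *_) gv≡0 ⟩
        0ℤ                             ∎)

    B≡A⊕half : ∀ y → B y ≡ A (y ⊕ half)
    B≡A⊕half y = ⟦⟧-injective (begin
      ⟦ B y ⟧                            ≡⟨ β≡ y ⟩
      1ℤ - α y + ε y                     ≡⟨ split (α y) (α (y ⊕ half)) (ε y) ⟩
      α (y ⊕ half) + g y                 ≡⟨ cong (λ z → α (y ⊕ half) + z) (g≡0 y) ⟩
      α (y ⊕ half) + 0ℤ                  ≡⟨ ℤ.+-identityʳ (α (y ⊕ half)) ⟩
      ⟦ A (y ⊕ half) ⟧                   ∎)
      where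
      split : ∀ a a' e → 1ℤ - a + e ≡ a' + (1ℤ + e - (a + a'))
      split = solve-∀

lemma3 : (j : ℕ) (r : ℤ) (A B : Subset (2 ℕ.* suc j)) →
    (∀ x → (A x ∨ B x) ≡ true) →
    (∀ x → (A x ∧ B x) ≡ true ⇔ ((x ≡ clsℤ r) ⊎ (x ≡ clsℤ (r + + suc j)))) →
    ((∀ n → R A n ≡ R B n) ⇔ (∀ x → B x ≡ (A +ˢ cls (suc j)) x))
lemma3 j r A B A∪B A∩B = mk⇔
  (λ R≡ x → trans (B≡A⊕half R≡ x) (sym (+ˢ-half A x)))
  (λ B≡ n → trans (sym (R-⊕half A n)) (R-cong (λ x → sym (trans (B≡ x) (+ˢ-half A x))) n))
  where
  open EvenModulus j

  r₀ : Fin (2 ℕ.* suc j)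
  r₀ = clsℤ r

  A∩B≡ : ∀ x → T (A x ∧ B x) ⇔ (x ≡ r₀ ⊎ x ≡ r₀ ⊕ half)
  A∩B≡ x = mk⇔
    (Sum.map₂ (λ eq → trans eq (clsℤ-+ r (suc j))) ∘ Equivalence.to (A∩B x) ∘ Equivalence.to T-≡)
    (Equivalence.from T-≡ ∘ Equivalence.from (A∩B x) ∘ Sum.map₂ (λ eq → trans eq (sym (clsℤ-+ r (suc j)))))

  A∩B-δ : ∀ x → ⟦ A x ∧ B x ⟧ ≡ δ x r₀ + δ x (r₀ ⊕ half)
  A∩B-δ x = trans (cong ⟦_⟧ (does-⇔ (A∩B≡ x) (T? (A x ∧ B x)) (x ≟ r₀ ⊎-dec x ≟ r₀ ⊕ half)))
                  (⟦⊎-dec⟧ (x ≟ r₀) (x ≟ r₀ ⊕ half) (λ { (refl , eq) → x≢x⊕half x eq }))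

  open Complement j r₀ A B A∪B A∩B-δ using (B≡A⊕half)
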